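{- For every positive integer $r$ there exist positive real numbers $c_1=c_1(r)$ and $c_2=c_2(r)$ such that the following holds. Let $h=\binom{r+1}{2}$, and let $\mathcal{H}$ be an $r$-partite $r$-uniform hypergraph with vertex classes $A_1,\dots,A_r$, $|A_1|=\dots=|A_r|=n$. Then there exist positive integers $t_1,\dots,t_r$ and a subhypergraph $\mathcal{H}'$ of $\mathcal{H}$ such that (1) for $i=1,\dots,r$ and every $X\in C_i(\mathcal{H}')$, we have $t_i\leq d_{\mathcal{H}'}(X)<c_1t_i(\log n)^h$; (2) $\mathcal{H}'$ has at least $c_2|E(\mathcal{H})|(\log n)^{ -h}$ edges.
   Context: For an $r$-partite $r$-uniform hypergraph with classes $A_1,\dots,A_r$ (every edge meets each class in exactly one vertex), $B_i$ denotes the family of $(r-1)$-element vertex sets $X$ with $|X\cap A_j|=1$ for all $j\neq i$. For a subhypergraph $\mathcal{H}'$ on the same vertex classes, $d_{\mathcal{H}'}(X)$ is the number of edges of $\mathcal{H}'$ containing $X$, and $C_i(\mathcal{H}')=\{X\in B_i: d_{\mathcal{H}'}(X)>0\}$. -}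

module Defs where

open import Data.Nat using (ℕ; zero; suc; _+_; _*_; _^_)
open import Data.Bool using (Bool; true; false; if_then_else_)
open import Data.Fin using (Fin)
open import Data.Vec using (Vec; []; _∷_; _[_]≔_)
open import Data.List using (List; []; _∷_; concatMap; map; allFin)
open import Data.Nat.Logarithm using (⌊log₂_⌋)

-- An edge of an r-partite r-uniform hypergraph whose classes A_1..A_r are
-- each identified with Fin n: the tuple of its vertices, one per class.
Edge : ℕ → ℕ → Set
Edge r n = Vec (Fin n) r

Hypergraph : ℕ → ℕ → Set
Hypergraph r n = Edge r n → Bool

allEdges : (r n : ℕ) → List (Edge r n)
allEdges zero    n = [] ∷ []
allEdges (suc r) n = concatMap (λ v → map (v ∷_) (allEdges r n)) (allFin n)

countᵇ : {A : Set} → (A → Bool) → List A → ℕ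
countᵇ p []       = 0
countᵇ p (x ∷ xs) = (if p x then 1 else 0) + countᵇ p xs

numEdges : {r n : ℕ} → Hypergraph r n → ℕ
numEdges {r} {n} H = countᵇ H (allEdges r n)

_⊆ᴴ_ : {r n : ℕ} → Hypergraph r n → Hypergraph r n → Set
H' ⊆ᴴ H = ∀ e → H' e ≡ true → H e ≡ true
  where open import Relation.Binary.PropositionalEquality using (_≡_)

-- A set X ∈ B_i is represented by any tuple x : Edge r n, the i-th entry
-- being ignored (X = {x_j : j ≠ i}).  d_H(X) = number of edges of H
-- containing X = number of v ∈ A_i with (x with x_i := v) ∈ E(H).
deg : {r n : ℕ} → Hypergraph r n → Fin r → Edge r n → ℕ
deg {r} {n} H i x = countᵇ (λ v → H (x [ i ]≔ v)) (allFin n)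

-- Integer stand-in for log n: ⌊log₂ n⌋.
logN : ℕ → ℕ
logN n = ⌊log₂ n ⌋

-- Give each edge e of H the vector of dyadic classes kᵢ = ⌊log₂ d_H(e ∖ Aᵢ)⌋ ≤ L = logN n. Some
-- class H₁ among the (1 + L)^r ≤ 2^r L^h classes keeps a 2^{-r} L^{-h} fraction of the edges, and in
-- H₁ every degree d_H(X) with X ∈ Cᵢ(H₁) lies in [2^kᵢ, 2^(kᵢ+1)). Inside H₁ now delete, one star at a
-- time, the edges through any X ∈ Cᵢ whose degree is below tᵢ = 1 + ⌊2^kᵢ / D⌋. Such a step deletes
-- fewer than tᵢ edges but takes X out of Cᵢ, so the at least 2^kᵢ ≥ D (tᵢ − 1) edges of H through X
-- stop being covered; as at most r |E(H)| edges can ever become uncovered, at most r |E(H)| / D edges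
-- are deleted, which is at most half of |E(H₁)| for D = 2 r 2^r L^h. The surviving edges satisfy
-- tᵢ ≤ d(X) < 2^(kᵢ+1) < 2 D tᵢ.

module Submission where

open import Defs
open import Data.Bool using (Bool; true; false; _∧_; not; if_then_else_)
open import Data.Bool.Properties using (∧-zeroʳ; ∧-identityʳ)
open import Data.Fin using (Fin; zero; suc; toℕ; fromℕ<)
open import Data.Fin.Properties using (any?; toℕ-fromℕ<) renaming (_≟_ to _≟ᶠ_)
open import Data.List using (List; []; _∷_; _++_; map; concatMap; allFin; tabulate; length)
open import Data.List.Membership.Propositional using (_∈_)
open import Data.List.Membership.Propositional.Properties using (∈-allFin)
open import Data.List.Properties using (length-tabulate)
open import Data.List.Relation.Unary.Any using (here; there)
open import Data.Nat
  using (ℕ; zero; suc; pred; _+_; _*_; _^_; _≤_; _<_; z≤n; s≤s; _≤?_; _<?_; NonZero; >-nonZero; >-nonZero⁻¹)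
open import Data.Nat.Combinatorics using (_C_; nC1≡n; nCk+nC[k+1]≡[n+1]C[k+1])
open import Data.Nat.DivMod using (_/_; _%_; m/n*n≤m; m≡m%n+[m/n]*n; m%n<n)
open import Data.Nat.Induction using (<-wellFounded)
open import Data.Nat.ListAction using (sum)
open import Data.Nat.Logarithm using (⌊log₂⌋-mono-≤; ⌊log₂[2^n]⌋≡n)
open import Data.Nat.Properties
open import Algebra.Properties.CommutativeSemigroup +-commutativeSemigroup using (interchange)
open import Data.Nat.Tactic.RingSolver using (solve-∀)
open import Data.Product using (Σ; _×_; _,_; proj₁; proj₂)
open import Data.Vec using (Vec; []; _∷_; _[_]≔_; lookup; replicate) renaming (tabulate to tabulateᵛ)
open import Data.Vec.Properties using (≡-dec; []≔-idempotent; []≔-lookup; lookup∘update; lookup∘tabulate)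
open import Function using (_∘_; id; case_of_)
open import Induction.WellFounded using (Acc; acc)
open import Relation.Binary.Definitions using (DecidableEquality)
open import Relation.Binary.PropositionalEquality
open import Relation.Nullary using (Dec; yes; no; does)
open import Relation.Nullary.Decidable using (dec-true; _×-dec_)

indicator : Bool → ℕ
indicator b = if b then 1 else 0

indicator-mono : {a b : Bool} → (a ≡ true → b ≡ true) → indicator a ≤ indicator b
indicator-mono {false} _   = z≤n
indicator-mono {true}  a⇒b rewrite a⇒b refl = ≤-refl

module _ {A : Set} where

  countᵇ-cong : {p q : A → Bool} → (∀ a → p a ≡ q a) → ∀ xs → countᵇ p xs ≡ countᵇ q xs
  countᵇ-cong p≗q []       = refl
  countᵇ-cong p≗q (x ∷ xs) = cong₂ _+_ (cong indicator (p≗q x)) (countᵇ-cong p≗q xs)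

  countᵇ-mono : {p q : A → Bool} → (∀ a → p a ≡ true → q a ≡ true) → ∀ xs → countᵇ p xs ≤ countᵇ q xs
  countᵇ-mono p⇒q []       = z≤n
  countᵇ-mono p⇒q (x ∷ xs) = +-mono-≤ (indicator-mono (p⇒q x)) (countᵇ-mono p⇒q xs)

  countᵇ-false : ∀ xs → countᵇ {A} (λ _ → false) xs ≡ 0
  countᵇ-false []       = refl
  countᵇ-false (_ ∷ xs) = countᵇ-false xs

  countᵇ-true : ∀ xs → countᵇ {A} (λ _ → true) xs ≡ length xs
  countᵇ-true []       = refl
  countᵇ-true (_ ∷ xs) = cong suc (countᵇ-true xs)

  countᵇ-≤-length : (p : A → Bool) (xs : List A) → countᵇ p xs ≤ length xs
  countᵇ-≤-length p xs = subst (countᵇ p xs ≤_) (countᵇ-true xs) (countᵇ-mono (λ _ _ → refl) xs)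

  countᵇ-split : (p q : A → Bool) (xs : List A) → countᵇ p xs ≡ countᵇ (λ a → p a ∧ not (q a)) xs + countᵇ (λ a → p a ∧ q a) xs
  countᵇ-split p q [] = refl
  countᵇ-split p q (x ∷ xs) with p x | q x
  ... | false | _     = countᵇ-split p q xs
  ... | true  | false = cong suc (countᵇ-split p q xs)
  ... | true  | true  = trans (cong suc (countᵇ-split p q xs)) (sym (+-suc _ _))

  countᵇ-∧-if : (p q : A → Bool) (b : Bool) (xs : List A) → countᵇ (λ a → p a ∧ (b ∧ q a)) xs ≡ (if b then countᵇ (λ a → p a ∧ q a) xs else 0)
  countᵇ-∧-if p q true  xs = refl
  countᵇ-∧-if p q false xs = trans (countᵇ-cong (λ a → ∧-zeroʳ (p a)) xs) (countᵇ-false xs)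

  countᵇ-∈ : ∀ {p : A → Bool} {a xs} → a ∈ xs → p a ≡ true → 1 ≤ countᵇ p xs
  countᵇ-∈ (here refl) pa rewrite pa = s≤s z≤n
  countᵇ-∈ {p} {xs = x ∷ _} (there a∈xs) pa = ≤-trans (countᵇ-∈ a∈xs pa) (m≤n+m _ (indicator (p x)))

  countᵇ-witness : (p : A → Bool) (xs : List A) → 1 ≤ countᵇ p xs → Σ A λ a → p a ≡ true
  countᵇ-witness p (x ∷ xs) 1≤c with p x in px
  ... | true  = x , px
  ... | false = countᵇ-witness p xs 1≤c

  countᵇ-++ : (p : A → Bool) (xs ys : List A) → countᵇ p (xs ++ ys) ≡ countᵇ p xs + countᵇ p ys
  countᵇ-++ p []       ys = refl
  countᵇ-++ p (x ∷ xs) ys = trans (cong (indicator (p x) +_) (countᵇ-++ p xs ys)) (sym (+-assoc (indicator (p x)) _ _))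

  countᵇ-as-sum : (p : A → Bool) (xs : List A) → countᵇ p xs ≡ sum (map (indicator ∘ p) xs)
  countᵇ-as-sum p []       = refl
  countᵇ-as-sum p (x ∷ xs) = cong (indicator (p x) +_) (countᵇ-as-sum p xs)

  sum-map-+ : ∀ (f g : A → ℕ) xs → sum (map (λ a → f a + g a) xs) ≡ sum (map f xs) + sum (map g xs)
  sum-map-+ f g []       = refl
  sum-map-+ f g (x ∷ xs) = trans (cong (f x + g x +_) (sum-map-+ f g xs)) (interchange (f x) (g x) _ _)

  exists-≥-average : (f : A → ℕ) → A → (cs : List A) → Σ A λ c → sum (map f cs) ≤ length cs * f c
  exists-≥-average f d [] = d , z≤n
  exists-≥-average f d (x ∷ xs) with exists-≥-average f d xs
  ... | c , avg with f x ≤? f c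
  ... | yes fx≤fc = c , +-mono-≤ fx≤fc avg
  ... | no  fx≰fc = x , +-monoʳ-≤ (f x) (≤-trans avg (*-monoʳ-≤ (length xs) (<⇒≤ (≰⇒> fx≰fc))))

∑ : (n : ℕ) → (Fin n → ℕ) → ℕ
∑ zero    f = 0
∑ (suc n) f = f zero + ∑ n (f ∘ suc)

∑-cong : ∀ n {f g : Fin n → ℕ} → (∀ i → f i ≡ g i) → ∑ n f ≡ ∑ n g
∑-cong zero    f≗g = refl
∑-cong (suc n) f≗g = cong₂ _+_ (f≗g zero) (∑-cong n (f≗g ∘ suc))

∑-mono : ∀ n {f g : Fin n → ℕ} → (∀ i → f i ≤ g i) → ∑ n f ≤ ∑ n g
∑-mono zero    f≤g = z≤n
∑-mono (suc n) f≤g = +-mono-≤ (f≤g zero) (∑-mono n (f≤g ∘ suc))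

∑-const : ∀ n k → ∑ n (λ _ → k) ≡ n * k
∑-const zero    k = refl
∑-const (suc n) k = cong (k +_) (∑-const n k)

∑-select : ∀ n (a : Fin n) (f : Fin n → ℕ) → ∑ n (λ v → if does (a ≟ᶠ v) then f v else 0) ≡ f a
∑-select (suc n) zero    f = trans (cong (f zero +_) (trans (∑-const n 0) (*-zeroʳ n))) (+-identityʳ _)
∑-select (suc n) (suc a) f = ∑-select n a (f ∘ suc)

∑-mono-+ : ∀ n {f g : Fin n → ℕ} (i : Fin n) {a} → (∀ j → f j ≤ g j) → f i + a ≤ g i → ∑ n f + a ≤ ∑ n g
∑-mono-+ (suc n) {f} zero {a} f≤g fi+a≤gi = begin
  f zero + ∑ n (f ∘ suc) + a   ≡⟨ +-assoc (f zero) _ a ⟩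
  f zero + (∑ n (f ∘ suc) + a) ≡⟨ cong (f zero +_) (+-comm _ a) ⟩
  f zero + (a + ∑ n (f ∘ suc)) ≡⟨ +-assoc (f zero) a _ ⟨
  f zero + a + ∑ n (f ∘ suc)   ≤⟨ +-mono-≤ fi+a≤gi (∑-mono n (f≤g ∘ suc)) ⟩
  _                            ∎
  where open ≤-Reasoning
∑-mono-+ (suc n) {f} (suc i) {a} f≤g fi+a≤gi = begin
  f zero + ∑ n (f ∘ suc) + a   ≡⟨ +-assoc (f zero) _ a ⟩
  f zero + (∑ n (f ∘ suc) + a) ≤⟨ +-mono-≤ (f≤g zero) (∑-mono-+ n i (f≤g ∘ suc) fi+a≤gi) ⟩
  _                            ∎
  where open ≤-Reasoning

countᵇ-tabulate : ∀ {A : Set} n (g : Fin n → A) (p : A → Bool) → countᵇ p (tabulate g) ≡ ∑ n (indicator ∘ p ∘ g)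
countᵇ-tabulate zero    g p = refl
countᵇ-tabulate (suc n) g p = cong (indicator (p (g zero)) +_) (countᵇ-tabulate n (g ∘ suc) p)

countᵇ-concatMap-tabulate : ∀ {A B : Set} n (g : Fin n → A) (f : A → List B) (p : B → Bool) →
  countᵇ p (concatMap f (tabulate g)) ≡ ∑ n (λ v → countᵇ p (f (g v)))
countᵇ-concatMap-tabulate zero    g f p = refl
countᵇ-concatMap-tabulate (suc n) g f p =
  trans (countᵇ-++ p (f (g zero)) _) (cong (countᵇ p (f (g zero)) +_) (countᵇ-concatMap-tabulate n (g ∘ suc) f p))

countᵇ-map : ∀ {A B : Set} (f : A → B) (p : B → Bool) (xs : List A) → countᵇ p (map f xs) ≡ countᵇ (p ∘ f) xs
countᵇ-map f p []       = refl
countᵇ-map f p (x ∷ xs) = cong (indicator (p (f x)) +_) (countᵇ-map f p xs)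

infix 4 _≟ᵛ_
_≟ᵛ_ : ∀ {n k} → DecidableEquality (Vec (Fin n) k)
_≟ᵛ_ = ≡-dec _≟ᶠ_

allEdges-suc : ∀ r n (p : Edge (suc r) n → Bool) →
  countᵇ p (allEdges (suc r) n) ≡ ∑ n (λ v → countᵇ (p ∘ (v ∷_)) (allEdges r n))
allEdges-suc r n p =
  trans (countᵇ-concatMap-tabulate n id _ p) (∑-cong n (λ v → countᵇ-map (v ∷_) p (allEdges r n)))

length-allEdges : ∀ r n → length (allEdges r n) ≡ n ^ r
length-allEdges zero    n = refl
length-allEdges (suc r) n = begin
  length (allEdges (suc r) n)                      ≡⟨ countᵇ-true (allEdges (suc r) n) ⟨
  countᵇ (λ _ → true) (allEdges (suc r) n)         ≡⟨ allEdges-suc r n _ ⟩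
  ∑ n (λ _ → countᵇ (λ _ → true) (allEdges r n))   ≡⟨ ∑-cong n (λ _ → trans (countᵇ-true (allEdges r n)) (length-allEdges r n)) ⟩
  ∑ n (λ _ → n ^ r)                                ≡⟨ ∑-const n (n ^ r) ⟩
  n * n ^ r                                        ∎
  where open ≡-Reasoning

countᵇ-single : ∀ r n (q : Edge r n → Bool) (y : Edge r n) →
  countᵇ (λ e → q e ∧ does (y ≟ᵛ e)) (allEdges r n) ≡ indicator (q y)
countᵇ-single zero    n q [] = trans (+-identityʳ _) (cong indicator (∧-identityʳ (q [])))
countᵇ-single (suc r) n q (y ∷ ys) = begin
  _ ≡⟨ allEdges-suc r n _ ⟩
  _ ≡⟨ ∑-cong n (λ v → countᵇ-∧-if (q ∘ (v ∷_)) (does ∘ (ys ≟ᵛ_)) (does (y ≟ᶠ v)) (allEdges r n)) ⟩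
  _ ≡⟨ ∑-select n y (λ v → countᵇ (λ es → q (v ∷ es) ∧ does (ys ≟ᵛ es)) (allEdges r n)) ⟩
  _ ≡⟨ countᵇ-single r n (q ∘ (y ∷_)) ys ⟩
  _ ∎
  where open ≡-Reasoning

-- e contains the (r−1)-set of B_i represented by x, i.e. e agrees with x off coordinate i.
inStar : ∀ {r n} → Fin r → Edge r n → Edge r n → Bool
inStar i x e = does ((x [ i ]≔ lookup e i) ≟ᵛ e)

countᵇ-inStar : ∀ r n (p : Edge r n → Bool) (i : Fin r) (x : Edge r n) →
  countᵇ (λ e → p e ∧ inStar i x e) (allEdges r n) ≡ countᵇ (λ v → p (x [ i ]≔ v)) (allFin n)
countᵇ-inStar (suc r) n p zero (_ ∷ xs) = begin
  _ ≡⟨ allEdges-suc r n _ ⟩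
  _ ≡⟨ ∑-cong n (λ v → cong (λ b → countᵇ (λ es → p (v ∷ es) ∧ (b ∧ does (xs ≟ᵛ es))) (allEdges r n))
                             (dec-true (v ≟ᶠ v) refl)) ⟩
  _ ≡⟨ ∑-cong n (λ v → countᵇ-single r n (p ∘ (v ∷_)) xs) ⟩
  _ ≡⟨ countᵇ-tabulate n id (λ v → p (v ∷ xs)) ⟨
  _ ∎
  where open ≡-Reasoning
countᵇ-inStar (suc r) n p (suc i) (x ∷ xs) = begin
  _ ≡⟨ allEdges-suc r n _ ⟩
  _ ≡⟨ ∑-cong n (λ v → countᵇ-∧-if (p ∘ (v ∷_)) (inStar i xs) (does (x ≟ᶠ v)) (allEdges r n)) ⟩
  _ ≡⟨ ∑-select n x (λ v → countᵇ (λ es → p (v ∷ es) ∧ inStar i xs es) (allEdges r n)) ⟩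
  _ ≡⟨ countᵇ-inStar r n (p ∘ (x ∷_)) i xs ⟩
  _ ∎
  where open ≡-Reasoning

∧-trueˡ : ∀ {a b} → a ∧ b ≡ true → a ≡ true
∧-trueˡ {true} _ = refl

∧-trueʳ : ∀ {a b} → a ∧ b ≡ true → b ≡ true
∧-trueʳ {true} b≡true = b≡true

positive : ℕ → Bool
positive zero    = false
positive (suc _) = true

positive-≥1 : ∀ {m} → 1 ≤ m → positive m ≡ true
positive-≥1 (s≤s _) = refl

positive-mono : ∀ {m n} → m ≤ n → positive m ≡ true → positive n ≡ true
positive-mono {suc _} (s≤s _) _ = refl

module _ {r n : ℕ} where

  inStar-sound : ∀ i (x e : Edge r n) → inStar i x e ≡ true → x [ i ]≔ lookup e i ≡ e
  inStar-sound i x e inS with (x [ i ]≔ lookup e i) ≟ᵛ e | inS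
  ... | yes eq | _ = eq

  inStar-[]≔ : ∀ i (x : Edge r n) v → inStar i x (x [ i ]≔ v) ≡ true
  inStar-[]≔ i x v = dec-true (_ ≟ᵛ _) (cong (x [ i ]≔_) (lookup∘update i x v))

  deg-[]≔ : ∀ (G : Hypergraph r n) i x v → deg G i (x [ i ]≔ v) ≡ deg G i x
  deg-[]≔ G i x v = countᵇ-cong (λ u → cong G ([]≔-idempotent x i)) (allFin n)

  deg-inStar : ∀ (G : Hypergraph r n) i x e → inStar i x e ≡ true → deg G i e ≡ deg G i x
  deg-inStar G i x e inS = trans (cong (deg G i) (sym (inStar-sound i x e inS))) (deg-[]≔ G i x (lookup e i))

  deg-≥1 : ∀ (G : Hypergraph r n) i e → G e ≡ true → 1 ≤ deg G i e
  deg-≥1 G i e Ge = countᵇ-∈ (∈-allFin (lookup e i)) (trans (cong G ([]≔-lookup e i)) Ge)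

  deg-witness : ∀ (G : Hypergraph r n) i x → 1 ≤ deg G i x → Σ (Fin n) λ v → G (x [ i ]≔ v) ≡ true
  deg-witness G i x = countᵇ-witness _ (allFin n)

  deg-≤ : ∀ (G : Hypergraph r n) i x → deg G i x ≤ n
  deg-≤ G i x = subst (deg G i x ≤_) (length-tabulate id) (countᵇ-≤-length _ (allFin n))

  deg-mono : ∀ {G G' : Hypergraph r n} → G' ⊆ᴴ G → ∀ i x → deg G' i x ≤ deg G i x
  deg-mono G'⊆G i x = countᵇ-mono (λ v → G'⊆G _) (allFin n)

  deleteStar : Hypergraph r n → Fin r → Edge r n → Hypergraph r n
  deleteStar G i x e = G e ∧ not (inStar i x e)

  deleteStar-⊆ : ∀ G i x → deleteStar G i x ⊆ᴴ G
  deleteStar-⊆ G i x e = ∧-trueˡ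

  numEdges-deleteStar : ∀ G i x → numEdges G ≡ numEdges (deleteStar G i x) + deg G i x
  numEdges-deleteStar G i x = trans (countᵇ-split G (inStar i x) (allEdges r n))
    (cong (numEdges (deleteStar G i x) +_) (countᵇ-inStar r n G i x))

  deg-deleteStar : ∀ G i x e → inStar i x e ≡ true → deg (deleteStar G i x) i e ≡ 0
  deg-deleteStar G i x e inS = begin
    deg (deleteStar G i x) i e  ≡⟨ deg-inStar (deleteStar G i x) i x e inS ⟩
    deg (deleteStar G i x) i x  ≡⟨ countᵇ-cong deleted (allFin n) ⟩
    countᵇ (λ _ → false) (allFin n) ≡⟨ countᵇ-false (allFin n) ⟩
    0                           ∎
    where
    open ≡-Reasoning
    deleted : ∀ v → deleteStar G i x (x [ i ]≔ v) ≡ false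
    deleted v rewrite inStar-[]≔ i x v = ∧-zeroʳ _

  -- The number of edges e of H whose (r−1)-subset e ∖ Aᵢ lies in Cᵢ(G).
  coveredBy : Hypergraph r n → Hypergraph r n → Fin r → ℕ
  coveredBy H G i = countᵇ (λ e → H e ∧ positive (deg G i e)) (allEdges r n)

  coveredBy-≤ : ∀ H G i → coveredBy H G i ≤ numEdges H
  coveredBy-≤ H G i = countᵇ-mono (λ e → ∧-trueˡ) (allEdges r n)

  coveredBy-mono : ∀ H {G G' : Hypergraph r n} → G' ⊆ᴴ G → ∀ i → coveredBy H G' i ≤ coveredBy H G i
  coveredBy-mono H {G} {G'} G'⊆G i = countᵇ-mono covered (allEdges r n)
    where
    covered : ∀ e → (H e ∧ positive (deg G' i e)) ≡ true → (H e ∧ positive (deg G i e)) ≡ true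
    covered e Hc = cong₂ _∧_ (∧-trueˡ Hc) (positive-mono (deg-mono G'⊆G i e) (∧-trueʳ Hc))

  coveredBy-deleteStar : ∀ H G i x → 1 ≤ deg G i x →
    coveredBy H (deleteStar G i x) i + deg H i x ≤ coveredBy H G i
  coveredBy-deleteStar H G i x 1≤d = begin
    coveredBy H G' i + deg H i x
      ≤⟨ +-mono-≤ (countᵇ-mono outside (allEdges r n)) (≤-reflexive (sym inside)) ⟩
    countᵇ (λ e → c e ∧ not (inStar i x e)) (allEdges r n) + countᵇ (λ e → c e ∧ inStar i x e) (allEdges r n)
      ≡⟨ countᵇ-split c (inStar i x) (allEdges r n) ⟨
    coveredBy H G i
      ∎
    where
    open ≤-Reasoning
    G' : Hypergraph r n
    G' = deleteStar G i x
    c : Edge r n → Bool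
    c e = H e ∧ positive (deg G i e)
    outside : ∀ e → (H e ∧ positive (deg G' i e)) ≡ true → (c e ∧ not (inStar i x e)) ≡ true
    outside e Hc with inStar i x e in inS
    ... | true  = case subst (λ d → positive d ≡ true) (deg-deleteStar G i x e inS) (∧-trueʳ Hc) of λ ()
    ... | false = trans (∧-identityʳ _)
                    (cong₂ _∧_ (∧-trueˡ Hc) (positive-mono (deg-mono (deleteStar-⊆ G i x) i e) (∧-trueʳ Hc)))
    inside : countᵇ (λ e → c e ∧ inStar i x e) (allEdges r n) ≡ deg H i x
    inside = trans (countᵇ-cong inStar-covered (allEdges r n)) (countᵇ-inStar r n H i x)
      where
      inStar-covered : ∀ e → (c e ∧ inStar i x e) ≡ (H e ∧ inStar i x e)
      inStar-covered e with inStar i x e in inS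
      ... | false = trans (∧-zeroʳ _) (sym (∧-zeroʳ _))
      ... | true rewrite deg-inStar G i x e inS | positive-≥1 1≤d = ∧-identityʳ _

anyVec? : ∀ {n k} {P : Vec (Fin n) k → Set} → (∀ x → Dec (P x)) → Dec (Σ (Vec (Fin n) k) P)
anyVec? {k = zero} P? with P? []
... | yes p  = yes ([] , p)
... | no  ¬p = no λ { ([] , p) → ¬p p }
anyVec? {k = suc k} P? with any? (λ v → anyVec? (λ xs → P? (v ∷ xs)))
... | yes (v , xs , p) = yes (v ∷ xs , p)
... | no  ¬p           = no λ { (v ∷ xs , p) → ¬p (v , xs , p) }

record Pruned {r n : ℕ} (H G₀ : Hypergraph r n) (D : ℕ) (t : Fin r → ℕ) : Set where
  field
    core      : Hypergraph r n
    core⊆     : core ⊆ᴴ G₀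
    absorbed  : D * numEdges G₀ ≤ D * numEdges core + r * numEdges H
    minDegree : ∀ i x → 1 ≤ deg core i x → t i ≤ deg core i x

module _ {r n : ℕ} (H G₀ : Hypergraph r n) (D : ℕ) (lower t : Fin r → ℕ)
         (lower≤deg : ∀ i e → G₀ e ≡ true → lower i ≤ deg H i e)
         (cheap : ∀ i → D * pred (t i) ≤ lower i) where

  private
    potential : Hypergraph r n → ℕ
    potential G = ∑ r (coveredBy H G)

    -- D times the number of edges deleted from G₀ so far is at most the drop of the potential.
    Balanced : Hypergraph r n → Set
    Balanced G = D * numEdges G₀ + potential G ≤ D * numEdges G + potential G₀

    MinDegree : Hypergraph r n → Set
    MinDegree G = ∀ i x → 1 ≤ deg G i x → t i ≤ deg G i x

    LightStar : Hypergraph r n → Set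
    LightStar G = Σ (Fin r) λ i → Σ (Edge r n) λ x → 1 ≤ deg G i x × deg G i x < t i

    lightStar? : ∀ G → Dec (LightStar G)
    lightStar? G = any? (λ i → anyVec? (λ x → (1 ≤? deg G i x) ×-dec (deg G i x <? t i)))

    potential-deleteStar : ∀ {G} i x → G ⊆ᴴ G₀ → 1 ≤ deg G i x → potential (deleteStar G i x) + lower i ≤ potential G
    potential-deleteStar {G} i x G⊆G₀ 1≤d =
      ∑-mono-+ r i (coveredBy-mono H (deleteStar-⊆ G i x))
        (≤-trans (+-monoʳ-≤ _ lower≤deg-x) (coveredBy-deleteStar H G i x 1≤d))
      where
      lower≤deg-x : lower i ≤ deg H i x
      lower≤deg-x with deg-witness G i x 1≤d
      ... | v , Gv = subst (lower i ≤_) (deg-[]≔ H i x v) (lower≤deg i _ (G⊆G₀ _ Gv))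

    deleteStar-balanced : ∀ {G} i x → G ⊆ᴴ G₀ → 1 ≤ deg G i x → deg G i x < t i → Balanced G →
      Balanced (deleteStar G i x)
    deleteStar-balanced {G} i x G⊆G₀ 1≤d d<t balanced = +-cancelʳ-≤ (D * d) _ _ (begin
      D * numEdges G₀ + potential G' + D * d     ≤⟨ +-monoʳ-≤ _ (≤-trans (*-monoʳ-≤ D (<⇒≤pred d<t)) (cheap i)) ⟩
      D * numEdges G₀ + potential G' + lower i   ≡⟨ +-assoc (D * numEdges G₀) _ _ ⟩
      D * numEdges G₀ + (potential G' + lower i) ≤⟨ +-monoʳ-≤ _ (potential-deleteStar i x G⊆G₀ 1≤d) ⟩
      D * numEdges G₀ + potential G              ≤⟨ balanced ⟩
      D * numEdges G + potential G₀              ≡⟨ cong (λ m → D * m + potential G₀) (numEdges-deleteStar G i x) ⟩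
      D * (numEdges G' + d) + potential G₀       ≡⟨ rearrange D (numEdges G') d (potential G₀) ⟩
      D * numEdges G' + potential G₀ + D * d     ∎)
      where
      open ≤-Reasoning
      G' : Hypergraph r n
      G' = deleteStar G i x
      d : ℕ
      d = deg G i x
      rearrange : ∀ D a b c → D * (a + b) + c ≡ D * a + c + D * b
      rearrange = solve-∀

    prune : ∀ G → Acc _<_ (numEdges G) → G ⊆ᴴ G₀ → Balanced G →
      Σ (Hypergraph r n) λ G' → G' ⊆ᴴ G₀ × Balanced G' × MinDegree G'
    prune G (acc smaller) G⊆G₀ balanced with lightStar? G
    ... | no  noLightStar = G , G⊆G₀ , balanced , λ i x 1≤d → ≮⇒≥ (λ d<t → noLightStar (i , x , 1≤d , d<t))
    ... | yes (i , x , 1≤d , d<t) =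
      prune (deleteStar G i x) (smaller fewer) (λ e → G⊆G₀ e ∘ deleteStar-⊆ G i x e)
        (deleteStar-balanced i x G⊆G₀ 1≤d d<t balanced)
      where
      fewer : numEdges (deleteStar G i x) < numEdges G
      fewer = subst (numEdges (deleteStar G i x) <_) (sym (numEdges-deleteStar G i x)) (m<m+n _ 1≤d)

  pruned : Pruned H G₀ D t
  pruned with prune G₀ (<-wellFounded (numEdges G₀)) (λ _ → id) ≤-refl
  ... | G , G⊆G₀ , balanced , minDegree = record
    { core      = G
    ; core⊆     = G⊆G₀
    ; absorbed  = begin
        D * numEdges G₀               ≤⟨ m≤m+n _ (potential G) ⟩
        D * numEdges G₀ + potential G ≤⟨ balanced ⟩
        D * numEdges G + potential G₀ ≤⟨ +-monoʳ-≤ _ potential≤ ⟩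
        D * numEdges G + r * numEdges H ∎
    ; minDegree = minDegree
    }
    where
    open ≤-Reasoning
    potential≤ : potential G₀ ≤ r * numEdges H
    potential≤ = ≤-trans (∑-mono r (coveredBy-≤ H G₀)) (≤-reflexive (∑-const r (numEdges H)))

withClass : ∀ {r n m k} → (Edge r n → Vec (Fin m) k) → Hypergraph r n → Vec (Fin m) k → Hypergraph r n
withClass cls H c e = H e ∧ does (cls e ≟ᵛ c)

withClass-class : ∀ {r n m k} (cls : Edge r n → Vec (Fin m) k) H c e → withClass cls H c e ≡ true → cls e ≡ c
withClass-class cls H c e inClass with cls e ≟ᵛ c | ∧-trueʳ {H e} inClass
... | yes cls-e≡c | _ = cls-e≡c

countᵇ-partition : ∀ {A : Set} {m k} (p : A → Bool) (cls : A → Vec (Fin m) k) (xs : List A) →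
  countᵇ p xs ≡ sum (map (λ c → countᵇ (λ a → p a ∧ does (cls a ≟ᵛ c)) xs) (allEdges k m))
countᵇ-partition {m = m} {k} p cls [] =
  sym (trans (sym (countᵇ-as-sum (λ _ → false) (allEdges k m))) (countᵇ-false (allEdges k m)))
countᵇ-partition {m = m} {k} p cls (a ∷ as) = sym (begin
  sum (map (λ c → indicator (p a ∧ does (cls a ≟ᵛ c)) + countᵇ (λ a′ → p a′ ∧ does (cls a′ ≟ᵛ c)) as) classes)
    ≡⟨ sum-map-+ _ _ classes ⟩
  sum (map (λ c → indicator (p a ∧ does (cls a ≟ᵛ c))) classes) + _
    ≡⟨ cong₂ _+_ (trans (sym (countᵇ-as-sum _ classes)) (countᵇ-single k m (λ _ → p a) (cls a)))
                 (sym (countᵇ-partition p cls as)) ⟩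
  indicator (p a) + countᵇ p as
    ∎)
  where
  open ≡-Reasoning
  classes : List (Vec (Fin m) k)
  classes = allEdges k m

popularClass : ∀ {r n m k} (cls : Edge r n → Vec (Fin (suc m)) k) (H : Hypergraph r n) →
  Σ (Vec (Fin (suc m)) k) λ c → numEdges H ≤ suc m ^ k * numEdges (withClass cls H c)
popularClass {r} {n} {m} {k} cls H = c , (begin
  numEdges H                                     ≡⟨ countᵇ-partition H cls (allEdges r n) ⟩
  sum (map (numEdges ∘ withClass cls H) classes) ≤⟨ proj₂ popular ⟩
  length classes * numEdges (withClass cls H c)  ≡⟨ cong (_* numEdges (withClass cls H c)) (length-allEdges k (suc m)) ⟩
  suc m ^ k * numEdges (withClass cls H c)       ∎)
  where
  open ≤-Reasoning
  classes : List (Vec (Fin (suc m)) k)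
  classes = allEdges k (suc m)
  popular : Σ (Vec (Fin (suc m)) k) λ c → sum (map (numEdges ∘ withClass cls H) classes) ≤ length classes * numEdges (withClass cls H c)
  popular = exists-≥-average (numEdges ∘ withClass cls H) (replicate k zero) classes
  c : Vec (Fin (suc m)) k
  c = proj₁ popular

dyadicClass : ℕ → ℕ → ℕ
dyadicClass zero    d = 0
dyadicClass (suc L) d with 2 ^ suc L ≤? d
... | yes _ = suc L
... | no  _ = dyadicClass L d

dyadicClass-≤ : ∀ L d → dyadicClass L d ≤ L
dyadicClass-≤ zero    d = z≤n
dyadicClass-≤ (suc L) d with 2 ^ suc L ≤? d
... | yes _ = ≤-refl
... | no  _ = m≤n⇒m≤1+n (dyadicClass-≤ L d)

dyadicClass-bounds : ∀ L d → 1 ≤ d → d < 2 ^ suc L → 2 ^ dyadicClass L d ≤ d × d < 2 * 2 ^ dyadicClass L d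
dyadicClass-bounds zero    d 1≤d d<2^[1+L] = 1≤d , d<2^[1+L]
dyadicClass-bounds (suc L) d 1≤d d<2^[1+L] with 2 ^ suc L ≤? d
... | yes 2^[1+L]≤d = 2^[1+L]≤d , d<2^[1+L]
... | no  2^[1+L]≰d = dyadicClass-bounds L d 1≤d (≰⇒> 2^[1+L]≰d)

m<[1+m/n]*n : ∀ m n .{{_ : NonZero n}} → m < suc (m / n) * n
m<[1+m/n]*n m n = begin-strict
  m                 ≡⟨ m≡m%n+[m/n]*n m n ⟩
  m % n + m / n * n <⟨ +-monoˡ-< _ (m%n<n m n) ⟩
  n + m / n * n     ∎
  where open ≤-Reasoning

[1+m]^k≤2^k*m^k : ∀ m k .{{_ : NonZero m}} → suc m ^ k ≤ 2 ^ k * m ^ k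
[1+m]^k≤2^k*m^k m zero    = ≤-refl
[1+m]^k≤2^k*m^k m (suc k) = begin
  suc m * suc m ^ k         ≤⟨ *-mono-≤ 1+m≤2m ([1+m]^k≤2^k*m^k m k) ⟩
  2 * m * (2 ^ k * m ^ k)   ≡⟨ regroup m (2 ^ k) (m ^ k) ⟩
  2 * 2 ^ k * (m * m ^ k)   ∎
  where
  open ≤-Reasoning
  1+m≤2m : suc m ≤ 2 * m
  1+m≤2m = subst (suc m ≤_) (cong (m +_) (sym (+-identityʳ m))) (+-monoˡ-≤ m (>-nonZero⁻¹ m))
  regroup : ∀ m a b → 2 * m * (a * b) ≡ 2 * a * (m * b)
  regroup = solve-∀

r≤[1+r]C2 : ∀ r → r ≤ suc r C 2
r≤[1+r]C2 r = subst (r ≤_) (trans (cong (_+ r C 2) (sym (nC1≡n r))) (nCk+nC[k+1]≡[n+1]C[k+1] r 1)) (m≤m+n r (r C 2))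

a≤2c-by-absorption : ∀ r a b c .{{_ : NonZero r}} → a ≤ b → 2 * r * b ≤ 2 * r * c + r * a → a ≤ 2 * c
a≤2c-by-absorption r a b c a≤b absorbed = *-cancelˡ-≤ r (+-cancelʳ-≤ (r * a) _ _ (begin
  r * a + r * a         ≡⟨ double r a ⟩
  2 * r * a             ≤⟨ *-monoʳ-≤ (2 * r) a≤b ⟩
  2 * r * b             ≤⟨ absorbed ⟩
  2 * r * c + r * a     ≡⟨ cong (_+ r * a) (regroup r c) ⟩
  r * (2 * c) + r * a   ∎))
  where
  open ≤-Reasoning
  double : ∀ r a → r * a + r * a ≡ 2 * r * a
  double = solve-∀
  regroup : ∀ r c → 2 * r * c ≡ r * (2 * c)
  regroup = solve-∀

logN-≥1 : ∀ {n} → 2 ≤ n → 1 ≤ logN n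
logN-≥1 {n} 2≤n = subst (_≤ logN n) (⌊log₂[2^n]⌋≡n 1) (⌊log₂⌋-mono-≤ 2≤n)

n<2^[1+logN] : ∀ n → n < 2 ^ suc (logN n)
n<2^[1+logN] n = ≰⇒> λ 2^[1+logN]≤n →
  1+n≰n (subst (_≤ logN n) (⌊log₂[2^n]⌋≡n (suc (logN n))) (⌊log₂⌋-mono-≤ 2^[1+logN]≤n))

module Regularisation {r n : ℕ} .{{_ : NonZero r}} (L : ℕ) .{{_ : NonZero L}}
                      (n<2^[1+L] : n < 2 ^ suc L) (H : Hypergraph r n) where

  -- M ≥ (1 + L)^r bounds the number of degree classes, and D = 2 r M makes pruning lose at most
  -- half of the chosen class.
  h M D : ℕ
  h = suc r C 2
  M = 2 ^ r * L ^ h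
  D = 2 * r * M

  instance
    D≢0 : NonZero D
    D≢0 = m*n≢0 (2 * r) M {{m*n≢0 2 r}} {{m*n≢0 (2 ^ r) (L ^ h) {{m^n≢0 2 r}} {{m^n≢0 L h}}}}

  degreeClass : Edge r n → Vec (Fin (suc L)) r
  degreeClass e = tabulateᵛ (λ i → fromℕ< (s≤s (dyadicClass-≤ L (deg H i e))))

  c : Vec (Fin (suc L)) r
  c = proj₁ (popularClass degreeClass H)

  H₁ : Hypergraph r n
  H₁ = withClass degreeClass H c

  H≤[1+L]^r*H₁ : numEdges H ≤ suc L ^ r * numEdges H₁
  H≤[1+L]^r*H₁ = proj₂ (popularClass degreeClass H)

  lower : Fin r → ℕ
  lower i = 2 ^ toℕ (lookup c i)

  H₁-dyadic : ∀ i e → H₁ e ≡ true → lower i ≤ deg H i e × deg H i e < 2 * lower i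
  H₁-dyadic i e H₁e = subst (λ k → 2 ^ k ≤ deg H i e × deg H i e < 2 * 2 ^ k) (sym class-of-e)
    (dyadicClass-bounds L (deg H i e) (deg-≥1 H i e (∧-trueˡ H₁e)) (≤-<-trans (deg-≤ H i e) n<2^[1+L]))
    where
    class-of-e : toℕ (lookup c i) ≡ dyadicClass L (deg H i e)
    class-of-e = begin
      toℕ (lookup c i)                ≡⟨ cong (λ c′ → toℕ (lookup c′ i)) (withClass-class degreeClass H c e H₁e) ⟨
      toℕ (lookup (degreeClass e) i)  ≡⟨ cong toℕ (lookup∘tabulate _ i) ⟩
      _                               ≡⟨ toℕ-fromℕ< _ ⟩
      dyadicClass L (deg H i e)       ∎
      where open ≡-Reasoning

  t : Fin r → ℕ
  t i = suc (lower i / D)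

  open Pruned (pruned H H₁ D lower t (λ i e → proj₁ ∘ H₁-dyadic i e)
                 (λ i → subst (_≤ lower i) (*-comm (lower i / D) D) (m/n*n≤m (lower i) D)))
    public

  core⊆H : core ⊆ᴴ H
  core⊆H e = ∧-trueˡ ∘ core⊆ e

  core-maxDegree : ∀ i x → 1 ≤ deg core i x → deg core i x < 4 * r * 2 ^ r * t i * L ^ h
  core-maxDegree i x 1≤d with deg-witness core i x 1≤d
  ... | v , core-e = begin-strict
    deg core i x                ≤⟨ deg-mono core⊆H i x ⟩
    deg H i x                   ≡⟨ deg-[]≔ H i x v ⟨
    deg H i (x [ i ]≔ v)        <⟨ proj₂ (H₁-dyadic i (x [ i ]≔ v) (core⊆ _ core-e)) ⟩
    2 * lower i                 ≤⟨ *-monoʳ-≤ 2 (<⇒≤ (m<[1+m/n]*n (lower i) D)) ⟩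
    2 * (t i * D)               ≡⟨ regroup r (2 ^ r) (L ^ h) (t i) ⟩
    4 * r * 2 ^ r * t i * L ^ h ∎
    where
    open ≤-Reasoning
    regroup : ∀ r a b t → 2 * (t * (2 * r * (a * b))) ≡ 4 * r * a * t * b
    regroup = solve-∀

  edges-retained : numEdges H ≤ 2 * 2 ^ r * numEdges core * L ^ h
  edges-retained = subst (numEdges H ≤_) (regroup (2 ^ r) (L ^ h) (numEdges core))
    (a≤2c-by-absorption r (numEdges H) (M * numEdges H₁) (M * numEdges core) H≤M*H₁
      (subst₂ (λ a b → a ≤ b + r * numEdges H) (*-assoc (2 * r) M _) (*-assoc (2 * r) M _) absorbed))
    where
    H≤M*H₁ : numEdges H ≤ M * numEdges H₁
    H≤M*H₁ = ≤-trans H≤[1+L]^r*H₁ (*-monoˡ-≤ (numEdges H₁)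
      (≤-trans ([1+m]^k≤2^k*m^k L r) (*-monoʳ-≤ (2 ^ r) (^-monoʳ-≤ L (r≤[1+r]C2 r)))))
    regroup : ∀ a b m → 2 * (a * b * m) ≡ 2 * a * m * b
    regroup = solve-∀

lemma5p5 : (r : ℕ) → 1 ≤ r →
    Σ ℕ λ c₁ → Σ ℕ λ K → 1 ≤ c₁ × 1 ≤ K ×
      ((n : ℕ) → 2 ≤ n → (H : Hypergraph r n) →
        Σ (Fin r → ℕ) λ t → Σ (Hypergraph r n) λ H' →
          ((i : Fin r) → 1 ≤ t i) ×
          (H' ⊆ᴴ H) ×
          ((i : Fin r) → (x : Edge r n) → 1 ≤ deg H' i x →
            (t i ≤ deg H' i x) ×
            (deg H' i x < c₁ * t i * logN n ^ (suc r C 2))) ×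
          (numEdges H ≤ K * numEdges H' * logN n ^ (suc r C 2)))
lemma5p5 r@(suc _) _ =
  4 * r * 2 ^ r , 2 * 2 ^ r ,
  *-mono-≤ {1} {4 * r} (s≤s z≤n) (m^n>0 2 r) , *-mono-≤ {1} {2} (s≤s z≤n) (m^n>0 2 r) ,
  λ n 2≤n H →
    let open Regularisation (logN n) {{>-nonZero (logN-≥1 2≤n)}} (n<2^[1+logN] n) H
    in  t , core , (λ _ → s≤s z≤n) , core⊆H ,
        (λ i x 1≤d → minDegree i x 1≤d , core-maxDegree i x 1≤d) , edges-retained
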